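{- The operation $\operatorname{Linearize}:\subseteq\mathbb{AT}\to\mathbb{AT}_{\mathrm{pp}}$, which maps a proper finitely branching abstract tree to its unique proper pruned subtree, is a cylinder, i.e. $\mathrm{id}_{\mathbb{N}^\mathbb{N}}\times\operatorname{Linearize}\leq_{\mathrm{sW}}\operatorname{Linearize}$.
   Context: Notation: $\langle\cdot,\cdot\rangle$ is a standard computable pairing on $\mathbb{N}$; $(p)_n(k)=p(\langle n,k\rangle)$. For nonempty $s$, $\overleftarrow{s}$ is the $t$ with $s=\langle n\rangle^\frown t$. A concrete (labeled) tree is $(T,\phi)$ with $T\subseteq\mathbb{N}^{<\mathbb{N}}$ a tree and $\phi:T\setminus\{\langle\rangle\}\to\mathbb{N}$, $T$ empty or with at least two elements. It is finitely branching if each node has finitely many children; pruned if each node has at least one child; proper if $[T]\neq\emptyset$ and for all $x,y\in[T]$, $\phi(x|_{n+1})=\phi(y|_{n+1})$ for all $n$. $(T,\phi)$ is a subtree of $(T',\phi')$ if $T\subseteq T'$ and $\phi=\phi'|_T$. Coding: $X_0=\{p:\forall k\,((p)_k(0)=0\Rightarrow(p)_k=0^\omega)\}$, $X_{m+1}=\{p\in X_m:\forall k\,((p)_k(0)\neq0\Rightarrow\overleftarrow{(p)_k}\in X_m)\}$, $\mathrm{dom}(\delta_{\mathbb{CT}})=\bigcap_mX_m$. A nonempty $\sigma$ is a path through $p$ if $(p)_{\sigma(0)}(0)\neq0$ and, if $|\sigma|>1$, $\overleftarrow\sigma$ is a path through $\overleftarrow{(p)_{\sigma(0)}}$; its encoded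 label is $(p)_{\sigma(0)}(0)-1$ if $|\sigma|=1$, else the encoded label of $\overleftarrow\sigma$ in $\overleftarrow{(p)_{\sigma(0)}}$. $\delta_{\mathbb{CT}}(p)=(T,\phi)$ with $T$ = paths through $p$ plus $\langle\rangle$ if $p\neq0^\omega$, $T=\emptyset$ if $p=0^\omega$, $\phi$ = encoded labels. Bisimilarity of $(T_0,\phi_0),(T_1,\phi_1)$: $T_0=T_1=\emptyset$ or some $Z\subseteq T_0\times T_1$ with $\langle\rangle Z\langle\rangle$ such that whenever $\sigma Z\tau$: $|\sigma|=|\tau|$, $\phi_0(\sigma)=\phi_1(\tau)$ if $\sigma\neq\langle\rangle$, each child of $\sigma$ is $Z$-related to a child of $\tau$ and vice versa. $\mathbb{AT}$: represented space of abstract trees (bisimilarity classes), $\delta_{\mathbb{AT}}(p)=[\delta_{\mathbb{CT}}(p)]$; abstract trees have a property if some representative does; $A$ is a subtree of $A'$ if some representative of $A$ is a subtree of some representative of $A'$. $\mathbb{AT}_{\mathrm{pp}}$ is the subspace of proper pruned abstract trees. Represented spaces $(X,\delta_X)$ with partial surjections $\delta_X:\subseteq\mathbb{N}^\mathbb{N}\to X$; $F\vdash f$ if $\delta_Y(F(p))\in f(\delta_X(p))$ for $p\in\mathrm{dom}(f\delta_X)$; $f\leq_{\mathrm{sW}}g$ if there are computable $K,H:\subseteq\mathbb{N}^\mathbb{N}\to\mathbb{N}^\mathbb{N}$ with $KGH\vdash f$ for every $G\vdash g$. -}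

module Defs where

open import Data.Nat using (ℕ; zero; suc; _+_; _*_; _∸_; _<_)
open import Data.Fin using (Fin)
open import Data.Vec using (Vec; []; _∷_; lookup)
open import Data.List using (List; []; _∷_; _++_; [_]; length; applyUpTo)
open import Data.Product using (Σ; ∃; _×_; _,_)
open import Data.Sum using (_⊎_)
open import Data.Empty using (⊥)
open import Relation.Nullary using (¬_)
open import Relation.Binary.PropositionalEquality using (_≡_; _≢_)

Baire : Set
Baire = ℕ → ℕ

-- Cantor pairing  ⟨ n , k ⟩ = (n+k)(n+k+1)/2 + k
tri : ℕ → ℕ
tri zero    = 0
tri (suc t) = suc t + tri t

⟨_,_⟩ : ℕ → ℕ → ℕ
⟨ n , k ⟩ = tri (n + k) + k

sect : Baire → ℕ → Baire
sect p n k = p ⟨ n , k ⟩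

shift : Baire → Baire
shift q k = q (suc k)

-- product representation of ℕ^ℕ × Y : even / odd parts
evens odds : Baire → Baire
evens r n = r (2 * n)
odds  r n = r (suc (2 * n))

data PR : ℕ → Set where
  zer  : ∀ {n} → PR n
  succ : PR 1
  proj : ∀ {n} → Fin n → PR n
  comp : ∀ {m n} → PR m → Vec (PR n) m → PR n
  prec : ∀ {n} → PR n → PR (suc (suc n)) → PR (suc n)
  mu   : ∀ {n} → PR (suc n) → PR n
  orc  : PR 1

mutual
  data Eval (p : Baire) : ∀ {k} → PR k → Vec ℕ k → ℕ → Set where
    ev-zer  : ∀ {n} {xs : Vec ℕ n} → Eval p zer xs 0
    ev-succ : ∀ {x} → Eval p succ (x ∷ []) (suc x)
    ev-proj : ∀ {n} {i : Fin n} {xs} → Eval p (proj i) xs (lookup xs i)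
    ev-comp : ∀ {m n} {f : PR m} {gs : Vec (PR n) m} {xs ys v} →
              EvalV p gs xs ys → Eval p f ys v → Eval p (comp f gs) xs v
    ev-prec0 : ∀ {n} {g : PR n} {h} {xs v} →
               Eval p g xs v → Eval p (prec g h) (0 ∷ xs) v
    ev-precS : ∀ {n} {g : PR n} {h} {y xs u v} →
               Eval p (prec g h) (y ∷ xs) u → Eval p h (y ∷ u ∷ xs) v →
               Eval p (prec g h) (suc y ∷ xs) v
    ev-mu   : ∀ {n} {f : PR (suc n)} {xs y} →
              Eval p f (y ∷ xs) 0 →
              (∀ z → z < y → Σ ℕ λ u → u ≢ 0 × Eval p f (z ∷ xs) u) →
              Eval p (mu f) xs y
    ev-orc  : ∀ {x} → Eval p orc (x ∷ []) (p x)

  data EvalV (p : Baire) : ∀ {k m} → Vec (PR k) m → Vec ℕ k → Vec ℕ m → Set where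
    []  : ∀ {k} {xs : Vec ℕ k} → EvalV p [] xs []
    _∷_ : ∀ {k m} {g : PR k} {gs : Vec (PR k) m} {xs y ys} →
          Eval p g xs y → EvalV p gs xs ys → EvalV p (g ∷ gs) xs (y ∷ ys)

-- the code c computes (on oracle/input p) the output sequence q:
-- q(n) = Φ_c^p(n) for all n.  Computable K :⊆ ℕ^ℕ → ℕ^ℕ are exactly
-- the partial maps given (on their domain) by such a code.
Computes : PR 1 → Baire → Baire → Set
Computes c p q = ∀ n → Eval p c (n ∷ []) (q n)

record RawTree : Set₁ where
  constructor mkRaw
  field
    T : List ℕ → Set
    φ : List ℕ → ℕ
open RawTree public

child : List ℕ → ℕ → List ℕ
child σ n = σ ++ [ n ]

prefix : Baire → ℕ → List ℕ
prefix x n = applyUpTo x n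

IsTree : RawTree → Set
IsTree t =
  (∀ σ n → T t (child σ n) → T t σ) ×
  ((∀ σ → ¬ T t σ) ⊎ (Σ (List ℕ) λ σ → Σ (List ℕ) λ τ → T t σ × T t τ × σ ≢ τ))

FinBranching : RawTree → Set
FinBranching t = ∀ σ → T t σ → Σ ℕ λ b → ∀ n → T t (child σ n) → n < b

Pruned : RawTree → Set
Pruned t = ∀ σ → T t σ → Σ ℕ λ n → T t (child σ n)

Branch : RawTree → Baire → Set
Branch t x = ∀ n → T t (prefix x n)

Proper : RawTree → Set
Proper t = (Σ Baire λ x → Branch t x) ×
           (∀ x y → Branch t x → Branch t y →
              ∀ n → φ t (prefix x (suc n)) ≡ φ t (prefix y (suc n)))

Subtree : RawTree → RawTree → Set
Subtree t t' = (∀ σ → T t σ → T t' σ) ×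
               (∀ σ → T t σ → σ ≢ [] → φ t σ ≡ φ t' σ)

Bisim : RawTree → RawTree → Set₁
Bisim t₀ t₁ =
  ((∀ σ → ¬ T t₀ σ) × (∀ σ → ¬ T t₁ σ)) ⊎
  (Σ (List ℕ → List ℕ → Set) λ Z →
     (∀ σ τ → Z σ τ → T t₀ σ × T t₁ τ) ×
     Z [] [] ×
     (∀ σ τ → Z σ τ →
        (length σ ≡ length τ) ×
        (σ ≢ [] → φ t₀ σ ≡ φ t₁ τ) ×
        (∀ n → T t₀ (child σ n) → Σ ℕ λ m → T t₁ (child τ m) × Z (child σ n) (child τ m)) ×
        (∀ m → T t₁ (child τ m) → Σ ℕ λ n → T t₀ (child σ n) × Z (child σ n) (child τ m))))

X : ℕ → Baire → Set
X zero    p = ∀ k → sect p k 0 ≡ 0 → ∀ j → sect p k j ≡ 0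
X (suc m) p = X m p × (∀ k → sect p k 0 ≢ 0 → X m (shift (sect p k)))

DomCT : Baire → Set
DomCT p = ∀ m → X m p

IsPath : Baire → List ℕ → Set
IsPath p []            = ⊥
IsPath p (n ∷ [])      = sect p n 0 ≢ 0
IsPath p (n ∷ m ∷ σ)   = sect p n 0 ≢ 0 × IsPath (shift (sect p n)) (m ∷ σ)

label : Baire → List ℕ → ℕ
label p []          = 0   -- irrelevant (root carries no label)
label p (n ∷ [])    = sect p n 0 ∸ 1
label p (n ∷ m ∷ σ) = label (shift (sect p n)) (m ∷ σ)

δCT : Baire → RawTree
δCT p = mkRaw (λ σ → (σ ≡ [] × Σ ℕ λ k → p k ≢ 0) ⊎ IsPath p σ) (label p)

-- Abstract trees via codes p ∈ dom δ_CT (δ_AT(p) = [δ_CT(p)])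

HasProp : Baire → (RawTree → Set) → Set₁
HasProp p P = Σ RawTree λ t → IsTree t × P t × Bisim t (δCT p)

SubtreeAT : Baire → Baire → Set₁
SubtreeAT q p = Σ RawTree λ t → Σ RawTree λ t' →
  IsTree t × IsTree t' × Bisim t (δCT q) × Bisim t' (δCT p) × Subtree t t'

LinDom : Baire → Set₁
LinDom p = DomCT p × HasProp p (λ t → Proper t × FinBranching t)

LinOut : Baire → Baire → Set₁
LinOut p q = DomCT q × HasProp q (λ t → Proper t × Pruned t) × SubtreeAT q p

RealizesLin : (Baire → Baire) → Set₁
RealizesLin G = ∀ p → LinDom p → LinOut p (G p)

-- Write x = evens r and T for the tree coded by odds r. The forward reduction tags every label
-- ℓ at level d of T as ⟨ x d , ℓ ⟩; this changes no node, so the tagged tree is again proper and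
-- finitely branching, and untagging any name g of its linearization names Linearize T. That
-- tree is proper and pruned, hence has a node at every level n, and each of its nodes lies at
-- the same level in the tagged tree, so its label carries x n. The backward reduction thus
-- recovers x n by an unbounded search of g for a node at level n.

module Submission where

open import Defs
open import Data.Nat using (ℕ; zero; suc; _+_; _*_; _∸_; _≤_; _<_; z≤n; s≤s; _≤?_; _≟_)
open import Data.Nat.Properties
open import Data.Fin using (zero; suc)
open import Data.Vec using (Vec; []; _∷_)
open import Data.List using (List; []; _∷_; length; _∷ʳ_)
open import Data.List.Properties using (length-applyUpTo)
open import Data.List.Reverse using (Reverse; reverseView; []; _∶_∶ʳ_)
open import Data.Product using (Σ; _×_; _,_; proj₁; proj₂; swap)
open import Data.Sum using (_⊎_; inj₁; inj₂)
open import Data.Empty using (⊥-elim)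
open import Function using (case_of_)
open import Relation.Nullary using (¬_; yes; no)
open import Relation.Nullary.Decidable using (_×-dec_; ¬?)
open import Relation.Unary using (Decidable)
open import Relation.Binary.Definitions using (tri<; tri≈; tri>)
open import Relation.Binary.PropositionalEquality hiding ([_])

leq : ℕ → ℕ → ℕ
leq a b = 1 ∸ (a ∸ b)

leq-≤ : ∀ {a b} → a ≤ b → leq a b ≡ 1
leq-≤ a≤b = cong (1 ∸_) (m≤n⇒m∸n≡0 a≤b)

leq-≰ : ∀ {a b} → ¬ a ≤ b → leq a b ≡ 0
leq-≰ {a} {b} a≰b with a ∸ b in eq
... | zero  = ⊥-elim (a≰b (m∸n≡0⇒m≤n eq))
... | suc k = 0∸n≡0 k

tri-mono-≤ : ∀ {m n} → m ≤ n → tri m ≤ tri n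
tri-mono-≤ {zero}          _         = z≤n
tri-mono-≤ {suc m} {suc n} (s≤s m≤n) = s≤s (+-mono-≤ m≤n (tri-mono-≤ m≤n))

InTriBlock : ℕ → ℕ → Set
InTriBlock w i = tri w ≤ i × i < tri (suc w)

InTriBlock-unique : ∀ {i w w'} → InTriBlock w i → InTriBlock w' i → w ≡ w'
InTriBlock-unique {w = w} {w'} (lo , hi) (lo' , hi') with <-cmp w w'
... | tri≈ _ w≡w' _ = w≡w'
... | tri< w<w' _ _ = ⊥-elim (<-irrefl refl (<-≤-trans hi (≤-trans (tri-mono-≤ w<w') lo')))
... | tri> _ _ w>w' = ⊥-elim (<-irrefl refl (<-≤-trans hi' (≤-trans (tri-mono-≤ w>w') lo)))

-- Defined by recursion rather than by search so that it is primitive recursive.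
diagonal : ℕ → ℕ
diagonal zero    = 0
diagonal (suc i) = diagonal i + leq (tri (suc (diagonal i))) (suc i)

diagonal-InTriBlock : ∀ i → InTriBlock (diagonal i) i
diagonal-InTriBlock zero = z≤n , s≤s z≤n
diagonal-InTriBlock (suc i) with diagonal i | diagonal-InTriBlock i
... | d | lo , hi with tri (suc d) ≤? suc i
... | yes next≤ rewrite leq-≤ next≤ | +-comm d 1 =
  next≤ , s≤s (≤-trans (≤-reflexive (≤-antisym hi next≤)) (m≤n+m (tri (suc d)) (suc d)))
... | no next≰ rewrite leq-≰ next≰ | +-identityʳ d = m≤n⇒m≤1+n lo , ≰⇒> next≰

pair-InTriBlock : ∀ n k → InTriBlock (n + k) ⟨ n , k ⟩
pair-InTriBlock n k =
  m≤m+n _ _ , s≤s (≤-trans (≤-reflexive (+-comm (tri (n + k)) k)) (+-monoˡ-≤ _ (m≤n+m k n)))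

unpair₁ unpair₂ : ℕ → ℕ
unpair₂ i = i ∸ tri (diagonal i)
unpair₁ i = diagonal i ∸ unpair₂ i

diagonal-pair : ∀ n k → diagonal ⟨ n , k ⟩ ≡ n + k
diagonal-pair n k = InTriBlock-unique (diagonal-InTriBlock ⟨ n , k ⟩) (pair-InTriBlock n k)

unpair₂-pair : ∀ n k → unpair₂ ⟨ n , k ⟩ ≡ k
unpair₂-pair n k rewrite diagonal-pair n k = m+n∸m≡n (tri (n + k)) k

unpair₁-pair : ∀ n k → unpair₁ ⟨ n , k ⟩ ≡ n
unpair₁-pair n k rewrite unpair₂-pair n k | diagonal-pair n k = m+n∸n≡m n k

unpair₂≤ : ∀ i → unpair₂ i ≤ i
unpair₂≤ i = m∸n≤m i (tri (diagonal i))

unpair₂≤diagonal : ∀ i → unpair₂ i ≤ diagonal i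
unpair₂≤diagonal i = ≤-pred (begin-strict
  i ∸ tri (diagonal i)                                   <⟨ ∸-monoˡ-< hi lo ⟩
  tri (suc (diagonal i)) ∸ tri (diagonal i)              ≡⟨ cong (_∸ tri (diagonal i)) (+-comm (suc (diagonal i)) _) ⟩
  tri (diagonal i) + suc (diagonal i) ∸ tri (diagonal i) ≡⟨ m+n∸m≡n (tri (diagonal i)) _ ⟩
  suc (diagonal i)                                       ∎)
  where
  open ≤-Reasoning
  lo = proj₁ (diagonal-InTriBlock i)
  hi = proj₂ (diagonal-InTriBlock i)

pair-unpair : ∀ i → ⟨ unpair₁ i , unpair₂ i ⟩ ≡ i
pair-unpair i = begin
  tri (unpair₁ i + unpair₂ i) + unpair₂ i    ≡⟨ cong (λ d → tri d + unpair₂ i) (m∸n+n≡m (unpair₂≤diagonal i)) ⟩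
  tri (diagonal i) + (i ∸ tri (diagonal i)) ≡⟨ m+[n∸m]≡n (proj₁ (diagonal-InTriBlock i)) ⟩
  i                                          ∎
  where open ≡-Reasoning

inner : ℕ → ℕ
inner j = unpair₂ j ∸ 1

inner^ : ℕ → ℕ → ℕ
inner^ zero    j = j
inner^ (suc t) j = inner (inner^ t j)

sgn : ℕ → ℕ
sgn v = 1 ∸ (1 ∸ v)

descents : ℕ → ℕ → ℕ
descents zero    j = 0
descents (suc t) j = descents t j + sgn (unpair₂ (inner^ t j))

-- Position ⟨ n , 0 ⟩ of a code holds a node at level 0, and position ⟨ n , suc k ⟩ holds what
-- position k of the code shift (sect p n) holds, one level further down; depth counts these
-- descents. At most j of them occur, which keeps depth primitive recursive.
depth : ℕ → ℕ
depth j = descents j j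

inner^-suc : ∀ t j → inner^ (suc t) j ≡ inner^ t (inner j)
inner^-suc zero    j = refl
inner^-suc (suc t) j = cong inner (inner^-suc t j)

descents-suc : ∀ t j → descents (suc t) j ≡ sgn (unpair₂ j) + descents t (inner j)
descents-suc zero    j = +-comm 0 _
descents-suc (suc t) j rewrite descents-suc t j | inner^-suc t j = +-assoc (sgn (unpair₂ j)) _ _

inner^-0 : ∀ t → inner^ t 0 ≡ 0
inner^-0 zero = refl
inner^-0 (suc t) rewrite inner^-0 t = refl

descents-0 : ∀ t → descents t 0 ≡ 0
descents-0 zero = refl
descents-0 (suc t) rewrite descents-0 t | inner^-0 t = refl

inner^≤∸ : ∀ t j → inner^ t j ≤ j ∸ t
inner^≤∸ zero    j = ≤-refl
inner^≤∸ (suc t) j = begin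
  inner (inner^ t j) ≤⟨ ∸-monoˡ-≤ 1 (≤-trans (unpair₂≤ _) (inner^≤∸ t j)) ⟩
  j ∸ t ∸ 1          ≡⟨ ∸-+-assoc j t 1 ⟩
  j ∸ (t + 1)        ≡⟨ cong (j ∸_) (+-comm t 1) ⟩
  j ∸ suc t          ∎
  where open ≤-Reasoning

inner^-exhausted : ∀ t j → j ≤ t → inner^ t j ≡ 0
inner^-exhausted t j j≤t = n≤0⇒n≡0 (≤-trans (inner^≤∸ t j) (≤-reflexive (m≤n⇒m∸n≡0 j≤t)))

descents-stable : ∀ j k → descents (j + k) j ≡ depth j
descents-stable j zero    rewrite +-identityʳ j = refl
descents-stable j (suc k)
  rewrite +-suc j k | descents-stable j k | inner^-exhausted (j + k) j (m≤m+n j k) = +-identityʳ _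

depth-pair-zero : ∀ n → depth ⟨ n , 0 ⟩ ≡ 0
depth-pair-zero n with ⟨ n , 0 ⟩ | unpair₂-pair n 0
... | zero  | _     = refl
... | suc j | k≡0 rewrite descents-suc j (suc j) | k≡0 = descents-0 j

depth-pair-suc : ∀ n k → depth ⟨ n , suc k ⟩ ≡ suc (depth k)
depth-pair-suc n k with ⟨ n , suc k ⟩ | unpair₂-pair n (suc k) | m≤n+m (suc k) (tri (n + suc k))
... | suc j | e | s≤s k≤j rewrite descents-suc j (suc j) | e | 0∸n≡0 k =
  cong suc (subst (λ t → descents t k ≡ depth k) (m+[n∸m]≡n k≤j) (descents-stable k (j ∸ k)))

position : List ℕ → ℕ
position []          = 0
position (n ∷ [])    = ⟨ n , 0 ⟩
position (n ∷ m ∷ σ) = ⟨ n , suc (position (m ∷ σ)) ⟩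

IsPath-position : ∀ {g} σ → IsPath g σ → g (position σ) ≢ 0
IsPath-position (n ∷ [])    g≢0        = g≢0
IsPath-position (n ∷ m ∷ σ) (_ , path) = IsPath-position (m ∷ σ) path

position-IsPath : ∀ {g} σ → DomCT g → σ ≢ [] → g (position σ) ≢ 0 → IsPath g σ
position-IsPath []          _   σ≢[] _   = ⊥-elim (σ≢[] refl)
position-IsPath (n ∷ [])    _   _    g≢0 = g≢0
position-IsPath {g} (n ∷ m ∷ σ) dom _ g≢0 =
  head≢0 , position-IsPath (m ∷ σ) (λ k → proj₂ (dom (suc k)) n head≢0) (λ ()) g≢0
  where
  head≢0 : sect g n 0 ≢ 0
  head≢0 head≡0 = g≢0 (dom 0 n head≡0 (suc (position (m ∷ σ))))

label-position : ∀ {g} σ → σ ≢ [] → label g σ ≡ g (position σ) ∸ 1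
label-position []          σ≢[] = ⊥-elim (σ≢[] refl)
label-position (n ∷ [])    _    = refl
label-position (n ∷ m ∷ σ) _    = label-position (m ∷ σ) (λ ())

depth-position : ∀ σ → σ ≢ [] → depth (position σ) ≡ length σ ∸ 1
depth-position []          σ≢[] = ⊥-elim (σ≢[] refl)
depth-position (n ∷ [])    _    = depth-pair-zero n
depth-position (n ∷ m ∷ σ) _    =
  trans (depth-pair-suc n (position (m ∷ σ))) (cong suc (depth-position (m ∷ σ) (λ ())))

position-surjective : ∀ j → Σ (List ℕ) λ σ → σ ≢ [] × position σ ≡ j
position-surjective j = below (suc j) j ≤-refl
  where
  below : ∀ bound j → j < bound → Σ (List ℕ) λ σ → σ ≢ [] × position σ ≡ j
  below (suc bound) j (s≤s j≤bound) with unpair₂ j in k≡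
  ... | zero  = unpair₁ j ∷ [] , (λ ()) , trans (cong ⟨ unpair₁ j ,_⟩ (sym k≡)) (pair-unpair j)
  ... | suc k with below bound k (≤-trans (≤-trans (≤-reflexive (sym k≡)) (unpair₂≤ j)) j≤bound)
  ...   | []    , σ≢[] , _  = ⊥-elim (σ≢[] refl)
  ...   | m ∷ σ , _    , eq = unpair₁ j ∷ m ∷ σ , (λ ()) ,
    trans (cong (λ k → ⟨ unpair₁ j , suc k ⟩) eq) (trans (cong ⟨ unpair₁ j ,_⟩ (sym k≡)) (pair-unpair j))

IsPath-node : ∀ {p} σ → T (δCT p) σ → σ ≢ [] → IsPath p σ
IsPath-node σ (inj₁ (σ≡[] , _)) σ≢[] = ⊥-elim (σ≢[] σ≡[])
IsPath-node σ (inj₂ path)       _    = path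

≢[]-length : ∀ (σ τ : List ℕ) → length σ ≡ length τ → σ ≢ [] → τ ≢ []
≢[]-length []      _       _  σ≢[] = ⊥-elim (σ≢[] refl)
≢[]-length (_ ∷ _) (_ ∷ _) _  _    ()

PrefixClosed : RawTree → Set
PrefixClosed t = ∀ σ n → T t (child σ n) → T t σ

IsPath⇒≢[] : ∀ {g} σ → IsPath g σ → σ ≢ []
IsPath⇒≢[] (_ ∷ _) _ ()

IsPath-init : ∀ {g} σ n → IsPath g (child σ n) → σ ≢ [] → IsPath g σ
IsPath-init []          _ _             σ≢[] = ⊥-elim (σ≢[] refl)
IsPath-init (_ ∷ [])    _ (h≢0 , _)     _    = h≢0
IsPath-init (_ ∷ m ∷ σ) n (h≢0 , path) _    = h≢0 , IsPath-init (m ∷ σ) n path (λ ())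

δCT-prefixClosed : ∀ g → PrefixClosed (δCT g)
δCT-prefixClosed g []      n (inj₂ h≢0)  = inj₁ (refl , ⟨ n , 0 ⟩ , h≢0)
δCT-prefixClosed g (m ∷ σ) n (inj₂ path) = inj₂ (IsPath-init (m ∷ σ) n path (λ ()))
δCT-prefixClosed g (_ ∷ _) n (inj₁ (() , _))

Bisim-sym : ∀ {t₀ t₁} → Bisim t₀ t₁ → Bisim t₁ t₀
Bisim-sym (inj₁ (empty₀ , empty₁)) = inj₁ (empty₁ , empty₀)
Bisim-sym (inj₂ (Z , nodes , Z[] , back-and-forth)) =
  inj₂ ((λ τ σ → Z σ τ) , (λ τ σ σZτ → swap (nodes σ τ σZτ)) , Z[] , λ τ σ σZτ →
    let (len , lab , forth , back) = back-and-forth σ τ σZτ in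
    sym len , (λ τ≢[] → sym (lab (≢[]-length τ σ (sym len) τ≢[]))) , back , forth)

Bisim-simulates : ∀ {t₀ t₁} → Bisim t₀ t₁ → PrefixClosed t₀ → ∀ σ → T t₀ σ →
                  Σ (List ℕ) λ τ → T t₁ τ × length σ ≡ length τ × (σ ≢ [] → φ t₀ σ ≡ φ t₁ τ)
Bisim-simulates (inj₁ (empty₀ , _)) _ σ σ∈ = ⊥-elim (empty₀ σ σ∈)
Bisim-simulates {t₀} (inj₂ (Z , nodes , Z[] , back-and-forth)) closed σ σ∈ =
  let (τ , σZτ) = related (reverseView σ) σ∈
      (len , lab , _) = back-and-forth σ τ σZτ
  in τ , proj₂ (nodes σ τ σZτ) , len , lab
  where
  related : ∀ {σ} → Reverse σ → T t₀ σ → Σ (List ℕ) (Z σ)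
  related [] _ = [] , Z[]
  related (σ ∶ rσ ∶ʳ n) σn∈ =
    let (τ , σZτ) = related rσ (closed σ n σn∈)
        (m , _ , σnZτm) = proj₁ (proj₂ (proj₂ (back-and-forth σ τ σZτ))) n σn∈
    in τ ∷ʳ m , σnZτm

SubtreeAT-path : ∀ {g q} → SubtreeAT g q → ∀ σ → IsPath g σ →
                 Σ (List ℕ) λ τ → IsPath q τ × length σ ≡ length τ × label g σ ≡ label q τ
SubtreeAT-path {g} {q} (t , t' , _ , tree' , bisim , bisim' , nodes , labels) σ path
  with Bisim-simulates (Bisim-sym bisim) (δCT-prefixClosed g) σ (inj₂ path)
... | σ' , σ'∈ , len , lab with Bisim-simulates bisim' (proj₁ tree') σ' (nodes σ' σ'∈)
...   | τ , τ∈ , len' , lab' = τ , IsPath-node τ τ∈ (≢[]-length σ' τ len' σ'≢[]) , trans len len' , (begin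
  label g σ ≡⟨ lab σ≢[] ⟩
  φ t σ'    ≡⟨ labels σ' σ'∈ σ'≢[] ⟩
  φ t' σ'   ≡⟨ lab' σ'≢[] ⟩
  label q τ ∎)
  where
  open ≡-Reasoning
  σ≢[] = IsPath⇒≢[] σ path
  σ'≢[] = ≢[]-length σ σ' len σ≢[]

Branch-paths : ∀ {t g b} → Bisim t (δCT g) → PrefixClosed t → Branch t b →
               ∀ n → Σ (List ℕ) λ σ → IsPath g σ × length σ ≡ suc n
Branch-paths {b = b} bisim closed b∈ n with Bisim-simulates bisim closed (prefix b (suc n)) (b∈ (suc n))
... | σ , σ∈ , len , _ =
  σ , IsPath-node σ σ∈ (≢[]-length (prefix b (suc n)) σ len (λ ())) , trans (sym len) (length-applyUpTo b (suc n))

-- A code entry is 0 (no node) or 1 + the label of a node.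
relabelEntry : (ℕ → ℕ → ℕ) → ℕ → ℕ → ℕ
relabelEntry f d zero    = 0
relabelEntry f d (suc ℓ) = suc (f d ℓ)

relabelEntry-≡0 : ∀ {f d} v → relabelEntry f d v ≡ 0 → v ≡ 0
relabelEntry-≡0 zero _ = refl

relabelEntry-≢0 : ∀ {f d} v → v ≢ 0 → relabelEntry f d v ≢ 0
relabelEntry-≢0 zero    v≢0 = ⊥-elim (v≢0 refl)
relabelEntry-≢0 (suc v) _   ()

relabelEntry-label : ∀ {f d} v → v ≢ 0 → relabelEntry f d v ∸ 1 ≡ f d (v ∸ 1)
relabelEntry-label zero    v≢0 = ⊥-elim (v≢0 refl)
relabelEntry-label (suc v) _   = refl

relabelEntry-reindex : ∀ f (h : ℕ → ℕ) d v → relabelEntry f (h d) v ≡ relabelEntry (λ e → f (h e)) d v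
relabelEntry-reindex f h d zero    = refl
relabelEntry-reindex f h d (suc v) = refl

relabelEntry-inverse : ∀ {f f'} → (∀ d ℓ → f' d (f d ℓ) ≡ ℓ) →
                       ∀ d v → relabelEntry f' d (relabelEntry f d v) ≡ v
relabelEntry-inverse inv d zero    = refl
relabelEntry-inverse inv d (suc v) = cong suc (inv d v)

-- p' codes the tree of p with each label ℓ at level e replaced by f (d + e) ℓ; the offset d
-- is the level at which the section p sits inside an enclosing code.
Relabelled : (ℕ → ℕ → ℕ) → ℕ → Baire → Baire → Set
Relabelled f d p p' = ∀ i → p' i ≡ relabelEntry f (d + depth i) (p i)

relabel : (ℕ → ℕ → ℕ) → RawTree → RawTree
relabel f t = mkRaw (T t) (λ σ → f (length σ ∸ 1) (φ t σ))

module _ {f : ℕ → ℕ → ℕ} where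

  Relabelled-head : ∀ {d p p'} → Relabelled f d p p' → ∀ n → sect p' n 0 ≡ relabelEntry f d (sect p n 0)
  Relabelled-head {d} R n rewrite R ⟨ n , 0 ⟩ | depth-pair-zero n | +-identityʳ d = refl

  Relabelled-shift : ∀ {d p p'} → Relabelled f d p p' → ∀ n →
                     Relabelled f (suc d) (shift (sect p n)) (shift (sect p' n))
  Relabelled-shift {d} R n j rewrite R ⟨ n , suc j ⟩ | depth-pair-suc n j | +-suc d (depth j) = refl

  Relabelled-head≢0 : ∀ {d p p'} → Relabelled f d p p' → ∀ n → sect p n 0 ≢ 0 → sect p' n 0 ≢ 0
  Relabelled-head≢0 R n h≢0 h'≡0 = relabelEntry-≢0 _ h≢0 (trans (sym (Relabelled-head R n)) h'≡0)

  Relabelled-head≢0⁻ : ∀ {d p p'} → Relabelled f d p p' → ∀ n → sect p' n 0 ≢ 0 → sect p n 0 ≢ 0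
  Relabelled-head≢0⁻ R n h'≢0 h≡0 = h'≢0 (trans (Relabelled-head R n) (cong (relabelEntry f _) h≡0))

  Relabelled-X : ∀ m {d p p'} → Relabelled f d p p' → X m p → X m p'
  Relabelled-X zero {d} {p} R x k h'≡0 j
    rewrite R ⟨ k , j ⟩ | x k (relabelEntry-≡0 _ (trans (sym (Relabelled-head R k)) h'≡0)) j = refl
  Relabelled-X (suc m) R (x , xs) =
    Relabelled-X m R x , λ k h'≢0 → Relabelled-X m (Relabelled-shift R k) (xs k (Relabelled-head≢0⁻ R k h'≢0))

  Relabelled-DomCT : ∀ {d p p'} → Relabelled f d p p' → DomCT p → DomCT p'
  Relabelled-DomCT R dom m = Relabelled-X m R (dom m)

  Relabelled-IsPath : ∀ σ {d p p'} → Relabelled f d p p' → IsPath p σ → IsPath p' σ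
  Relabelled-IsPath (n ∷ [])    R h≢0          = Relabelled-head≢0 R n h≢0
  Relabelled-IsPath (n ∷ m ∷ σ) R (h≢0 , path) =
    Relabelled-head≢0 R n h≢0 , Relabelled-IsPath (m ∷ σ) (Relabelled-shift R n) path

  Relabelled-IsPath⁻ : ∀ σ {d p p'} → Relabelled f d p p' → IsPath p' σ → IsPath p σ
  Relabelled-IsPath⁻ (n ∷ [])    R h≢0          = Relabelled-head≢0⁻ R n h≢0
  Relabelled-IsPath⁻ (n ∷ m ∷ σ) R (h≢0 , path) =
    Relabelled-head≢0⁻ R n h≢0 , Relabelled-IsPath⁻ (m ∷ σ) (Relabelled-shift R n) path

  Relabelled-label : ∀ σ {d p p'} → Relabelled f d p p' → IsPath p σ →
                     label p' σ ≡ f (d + (length σ ∸ 1)) (label p σ)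
  Relabelled-label (n ∷ []) {d} R h≢0 rewrite Relabelled-head R n | +-identityʳ d = relabelEntry-label _ h≢0
  Relabelled-label (n ∷ m ∷ σ) {d} R (_ , path)
    rewrite Relabelled-label (m ∷ σ) (Relabelled-shift R n) path | +-suc d (length σ) = refl

  Relabelled-node : ∀ {p p'} → Relabelled f 0 p p' → ∀ σ → T (δCT p) σ → T (δCT p') σ
  Relabelled-node R σ (inj₁ (σ≡[] , k , pk≢0)) =
    inj₁ (σ≡[] , k , λ p'k≡0 → relabelEntry-≢0 _ pk≢0 (trans (sym (R k)) p'k≡0))
  Relabelled-node R σ (inj₂ path) = inj₂ (Relabelled-IsPath σ R path)

  Relabelled-node⁻ : ∀ {p p'} → Relabelled f 0 p p' → ∀ σ → T (δCT p') σ → T (δCT p) σ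
  Relabelled-node⁻ R σ (inj₁ (σ≡[] , k , p'k≢0)) =
    inj₁ (σ≡[] , k , λ pk≡0 → p'k≢0 (trans (R k) (cong (relabelEntry f _) pk≡0)))
  Relabelled-node⁻ R σ (inj₂ path) = inj₂ (Relabelled-IsPath⁻ σ R path)

relabel-Proper : ∀ {f} t → Proper t → Proper (relabel f t)
relabel-Proper {f} t (branch , agree) = branch , λ x y x∈ y∈ n →
  cong₂ f (cong (_∸ 1) (trans (length-applyUpTo x (suc n)) (sym (length-applyUpTo y (suc n)))))
          (agree x y x∈ y∈ n)

relabel-Subtree : ∀ {f t t'} → Subtree t t' → Subtree (relabel f t) (relabel f t')
relabel-Subtree {f} (nodes , labels) = nodes , λ σ σ∈ σ≢[] → cong (f (length σ ∸ 1)) (labels σ σ∈ σ≢[])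

module _ {f : ℕ → ℕ → ℕ} {p p' : Baire} (R : Relabelled f 0 p p') where

  Relabelled-Bisim : ∀ t → Bisim t (δCT p) → Bisim (relabel f t) (δCT p')
  Relabelled-Bisim t (inj₁ (empty , empty')) = inj₁ (empty , λ σ σ∈ → empty' σ (Relabelled-node⁻ R σ σ∈))
  Relabelled-Bisim t (inj₂ (Z , nodes , Z[] , back-and-forth)) =
    inj₂ (Z , (λ σ τ σZτ → proj₁ (nodes σ τ σZτ) , Relabelled-node R τ (proj₂ (nodes σ τ σZτ))) , Z[] ,
          λ σ τ σZτ → let (len , lab , forth , back) = back-and-forth σ τ σZτ in
            len ,
            (λ σ≢[] → let τ-path = IsPath-node τ (proj₂ (nodes σ τ σZτ)) (≢[]-length σ τ len σ≢[]) in
                      trans (cong₂ f (cong (_∸ 1) len) (lab σ≢[])) (sym (Relabelled-label τ R τ-path))) ,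
            (λ n σn∈ → let (m , τm∈ , σnZτm) = forth n σn∈ in m , Relabelled-node R _ τm∈ , σnZτm) ,
            (λ m τm∈ → back m (Relabelled-node⁻ R _ τm∈)))

  Relabelled-HasProp : ∀ {P} → (∀ t → P t → P (relabel f t)) → HasProp p P → HasProp p' P
  Relabelled-HasProp P-relabel (t , tree , Pt , bisim) = relabel f t , tree , P-relabel t Pt , Relabelled-Bisim t bisim

  Relabelled-LinDom : LinDom p → LinDom p'
  Relabelled-LinDom (dom , has) =
    Relabelled-DomCT R dom , Relabelled-HasProp (λ t (proper , finite) → relabel-Proper {f} t proper , finite) has

Relabelled-LinOut : ∀ {f p p' q q'} → Relabelled f 0 p p' → Relabelled f 0 q q' → LinOut p q → LinOut p' q'
Relabelled-LinOut {f} Rp Rq (dom , has , (t , t' , tree , tree' , bisim , bisim' , sub)) =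
  Relabelled-DomCT Rq dom ,
  Relabelled-HasProp Rq (λ t (proper , pruned) → relabel-Proper {f} t proper , pruned) has ,
  (relabel f t , relabel f t' , tree , tree' ,
   Relabelled-Bisim Rq t bisim , Relabelled-Bisim Rp t' bisim' , relabel-Subtree {f} sub)

NodeAt : Baire → ℕ → ℕ → Set
NodeAt g n y = depth y ≡ n × g y ≢ 0

NodeAt? : ∀ g n → Decidable (NodeAt g n)
NodeAt? g n y = (depth y ≟ n) ×-dec ¬? (g y ≟ 0)

IsPath-NodeAt : ∀ {g} σ → IsPath g σ → NodeAt g (length σ ∸ 1) (position σ)
IsPath-NodeAt σ path = depth-position σ (IsPath⇒≢[] σ path) , IsPath-position σ path

NodeAt-IsPath : ∀ {g n y} → DomCT g → NodeAt g n y →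
                Σ (List ℕ) λ σ → IsPath g σ × length σ ∸ 1 ≡ n × label g σ ≡ g y ∸ 1
NodeAt-IsPath {g} {y = y} dom (depth≡n , gy≢0) with position-surjective y
... | σ , σ≢[] , refl =
  σ , position-IsPath σ dom σ≢[] gy≢0 , trans (sym (depth-position σ σ≢[])) depth≡n , label-position σ σ≢[]

Minimal : (ℕ → Set) → Set
Minimal P = Σ ℕ λ y → P y × (∀ z → z < y → ¬ P z)

bounded-search : ∀ {P} → Decidable P → ∀ b → Minimal P ⊎ (∀ z → z < b → ¬ P z)
bounded-search P? zero = inj₂ λ _ ()
bounded-search P? (suc b) with bounded-search P? b
... | inj₁ found = inj₁ found
... | inj₂ none with P? b
...   | yes Pb  = inj₁ (b , Pb , none)
...   | no  ¬Pb = inj₂ λ z z<1+b → case m≤n⇒m<n∨m≡n (≤-pred z<1+b) of λ where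
  (inj₁ z<b)  → none z z<b
  (inj₂ refl) → ¬Pb

minimal-witness : ∀ {P j} → Decidable P → P j → Minimal P
minimal-witness {j = j} P? Pj with bounded-search P? (suc j)
... | inj₁ found = found
... | inj₂ none  = ⊥-elim (none j ≤-refl Pj)

parity : ℕ → ℕ
parity zero    = 0
parity (suc i) = 1 ∸ parity i

half : ℕ → ℕ
half zero    = 0
half (suc i) = half i + parity i

parity-half-even : ∀ n → parity (2 * n) ≡ 0 × half (2 * n) ≡ n
parity-half-even zero    = refl , refl
parity-half-even (suc n) =
  subst (λ m → parity m ≡ 0 × half m ≡ suc n) (sym (*-suc 2 n)) (step {2 * n} (parity-half-even n))
  where
  step : ∀ {m} → parity m ≡ 0 × half m ≡ n → parity (2 + m) ≡ 0 × half (2 + m) ≡ suc n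
  step (p≡0 , h≡n) rewrite p≡0 | h≡n = refl , trans (cong (_+ 1) (+-identityʳ n)) (+-comm n 1)

parity-half-odd : ∀ n → parity (suc (2 * n)) ≡ 1 × half (suc (2 * n)) ≡ n
parity-half-odd n rewrite proj₁ (parity-half-even n) | proj₂ (parity-half-even n) = refl , +-identityʳ n

ifZero : ℕ → ℕ → ℕ → ℕ
ifZero zero    a _ = a
ifZero (suc _) _ b = b

searchKey : Baire → ℕ → ℕ → ℕ
searchKey g z n = (n ∸ depth z) + (depth z ∸ n) + (1 ∸ g z)

searchKey≡0⇒NodeAt : ∀ g z n → searchKey g z n ≡ 0 → NodeAt g n z
searchKey≡0⇒NodeAt g z n key≡0 =
  ≤-antisym (m∸n≡0⇒m≤n (m+n≡0⇒n≡0 (n ∸ depth z) distance≡0)) (m∸n≡0⇒m≤n (m+n≡0⇒m≡0 _ distance≡0)) ,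
  λ gz≡0 → 1+n≢0 (trans (cong (1 ∸_) (sym gz≡0)) (m+n≡0⇒n≡0 _ key≡0))
  where distance≡0 = m+n≡0⇒m≡0 _ key≡0

NodeAt⇒searchKey≡0 : ∀ g z n → NodeAt g n z → searchKey g z n ≡ 0
NodeAt⇒searchKey≡0 g z n (refl , gz≢0) with g z
... | zero  = ⊥-elim (gz≢0 refl)
... | suc k rewrite n∸n≡0 (depth z) = 0∸n≡0 k

π₀ : ∀ {n} → PR (suc n)
π₀ = proj zero

π₁ : ∀ {n} → PR (suc (suc n))
π₁ = proj (suc zero)

π₂ : ∀ {n} → PR (suc (suc (suc n)))
π₂ = proj (suc (suc zero))

π₃ : ∀ {n} → PR (suc (suc (suc (suc n))))
π₃ = proj (suc (suc (suc zero)))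

comp₁ : ∀ {n} → PR 1 → PR n → PR n
comp₁ f g = comp f (g ∷ [])

comp₂ : ∀ {n} → PR 2 → PR n → PR n → PR n
comp₂ f g h = comp f (g ∷ h ∷ [])

oneᴾ : ∀ {n} → PR n
oneᴾ = comp₁ succ zer

addᴾ : PR 2
addᴾ = prec π₀ (comp₁ succ π₁)

predᴾ : PR 1
predᴾ = prec zer π₀

-- Recursion is on the first argument, so monusᴾ maps (b , a) to a ∸ b.
monusᴾ : PR 2
monusᴾ = prec π₀ (comp₁ predᴾ π₁)

triᴾ : PR 1
triᴾ = prec zer (comp₁ succ (comp₂ addᴾ π₀ π₁))

leqᴾ : PR 2
leqᴾ = comp₂ monusᴾ (comp₂ monusᴾ π₁ π₀) oneᴾ

diagonalᴾ : PR 1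
diagonalᴾ = prec zer (comp₂ addᴾ π₁ (comp₂ leqᴾ (comp₁ triᴾ (comp₁ succ π₁)) (comp₁ succ π₀)))

unpair₂ᴾ : PR 1
unpair₂ᴾ = comp₂ monusᴾ (comp₁ triᴾ diagonalᴾ) π₀

unpair₁ᴾ : PR 1
unpair₁ᴾ = comp₂ monusᴾ unpair₂ᴾ diagonalᴾ

pairᴾ : PR 2
pairᴾ = comp₂ addᴾ (comp₁ triᴾ addᴾ) π₁

sgnᴾ : PR 1
sgnᴾ = comp₂ monusᴾ (comp₂ monusᴾ π₀ oneᴾ) oneᴾ

inner^ᴾ : PR 2
inner^ᴾ = prec π₀ (comp₁ predᴾ (comp₁ unpair₂ᴾ π₁))

descentsᴾ : PR 2
descentsᴾ = prec zer (comp₂ addᴾ π₁ (comp₁ sgnᴾ (comp₁ unpair₂ᴾ (comp₂ inner^ᴾ π₀ π₂))))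

depthᴾ : PR 1
depthᴾ = comp₂ descentsᴾ π₀ π₀

doubleᴾ : PR 1
doubleᴾ = comp₂ addᴾ π₀ π₀

tagEntryᴾ : PR 2
tagEntryᴾ = prec zer (comp₁ succ (comp₂ pairᴾ π₂ π₀))

untagEntryᴾ : PR 1
untagEntryᴾ = prec zer (comp₁ succ (comp₁ unpair₂ᴾ π₀))

parityᴾ : PR 1
parityᴾ = prec zer (comp₂ monusᴾ π₁ oneᴾ)

halfᴾ : PR 1
halfᴾ = prec zer (comp₂ addᴾ π₁ (comp₁ parityᴾ π₀))

ifZeroᴾ : PR 3
ifZeroᴾ = prec π₀ π₃

searchKeyᴾ : PR 2
searchKeyᴾ =
  comp₂ addᴾ (comp₂ addᴾ (comp₂ monusᴾ (comp₁ depthᴾ π₀) π₁) (comp₂ monusᴾ π₁ (comp₁ depthᴾ π₀)))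
             (comp₂ monusᴾ (comp₁ orc π₀) oneᴾ)

levelValueᴾ : PR 1
levelValueᴾ = comp₁ unpair₁ᴾ (comp₁ predᴾ (comp₁ orc (mu searchKeyᴾ)))

tagProgram : PR 1
tagProgram = comp₂ tagEntryᴾ (comp₁ orc (comp₁ succ doubleᴾ)) (comp₁ orc (comp₁ doubleᴾ depthᴾ))

recoverProgram : PR 1
recoverProgram =
  comp ifZeroᴾ (parityᴾ ∷ comp₁ levelValueᴾ halfᴾ ∷ comp₁ untagEntryᴾ (comp₁ orc halfᴾ) ∷ [])

module _ {o : Baire} where

  eval-cast : ∀ {k} {c : PR k} {xs v w} → Eval o c xs v → v ≡ w → Eval o c xs w
  eval-cast e refl = e

  eval-comp₁ : ∀ {k} {f : PR 1} {g : PR k} {xs a v} →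
               Eval o g xs a → Eval o f (a ∷ []) v → Eval o (comp₁ f g) xs v
  eval-comp₁ eg ef = ev-comp (eg ∷ []) ef

  eval-comp₂ : ∀ {k} {f : PR 2} {g h : PR k} {xs a b v} →
               Eval o g xs a → Eval o h xs b → Eval o f (a ∷ b ∷ []) v → Eval o (comp₂ f g h) xs v
  eval-comp₂ eg eh ef = ev-comp (eg ∷ eh ∷ []) ef

  oneᴾ-eval : ∀ {k} {xs : Vec ℕ k} → Eval o oneᴾ xs 1
  oneᴾ-eval = eval-comp₁ ev-zer ev-succ

  addᴾ-eval : ∀ a b → Eval o addᴾ (a ∷ b ∷ []) (a + b)
  addᴾ-eval zero    b = ev-prec0 ev-proj
  addᴾ-eval (suc a) b = ev-precS (addᴾ-eval a b) (eval-comp₁ ev-proj ev-succ)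

  predᴾ-eval : ∀ a → Eval o predᴾ (a ∷ []) (a ∸ 1)
  predᴾ-eval zero    = ev-prec0 ev-zer
  predᴾ-eval (suc a) = ev-precS (predᴾ-eval a) ev-proj

  monusᴾ-eval : ∀ b a → Eval o monusᴾ (b ∷ a ∷ []) (a ∸ b)
  monusᴾ-eval zero    a = ev-prec0 ev-proj
  monusᴾ-eval (suc b) a =
    ev-precS (monusᴾ-eval b a) (eval-cast (eval-comp₁ ev-proj (predᴾ-eval (a ∸ b))) (pred[m∸n]≡m∸[1+n] a b))

  triᴾ-eval : ∀ a → Eval o triᴾ (a ∷ []) (tri a)
  triᴾ-eval zero    = ev-prec0 ev-zer
  triᴾ-eval (suc a) = ev-precS (triᴾ-eval a) (eval-comp₁ (eval-comp₂ ev-proj ev-proj (addᴾ-eval a (tri a))) ev-succ)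

  leqᴾ-eval : ∀ a b → Eval o leqᴾ (a ∷ b ∷ []) (leq a b)
  leqᴾ-eval a b = eval-comp₂ (eval-comp₂ ev-proj ev-proj (monusᴾ-eval b a)) oneᴾ-eval (monusᴾ-eval (a ∸ b) 1)

  diagonalᴾ-eval : ∀ i → Eval o diagonalᴾ (i ∷ []) (diagonal i)
  diagonalᴾ-eval zero    = ev-prec0 ev-zer
  diagonalᴾ-eval (suc i) = ev-precS (diagonalᴾ-eval i)
    (eval-comp₂ ev-proj
      (eval-comp₂ (eval-comp₁ (eval-comp₁ ev-proj ev-succ) (triᴾ-eval _)) (eval-comp₁ ev-proj ev-succ) (leqᴾ-eval _ _))
      (addᴾ-eval _ _))

  unpair₂ᴾ-eval : ∀ i → Eval o unpair₂ᴾ (i ∷ []) (unpair₂ i)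
  unpair₂ᴾ-eval i = eval-comp₂ (eval-comp₁ (diagonalᴾ-eval i) (triᴾ-eval _)) ev-proj (monusᴾ-eval _ _)

  unpair₁ᴾ-eval : ∀ i → Eval o unpair₁ᴾ (i ∷ []) (unpair₁ i)
  unpair₁ᴾ-eval i = eval-comp₂ (unpair₂ᴾ-eval i) (diagonalᴾ-eval i) (monusᴾ-eval _ _)

  pairᴾ-eval : ∀ a b → Eval o pairᴾ (a ∷ b ∷ []) ⟨ a , b ⟩
  pairᴾ-eval a b = eval-comp₂ (eval-comp₁ (addᴾ-eval a b) (triᴾ-eval (a + b))) ev-proj (addᴾ-eval (tri (a + b)) b)

  sgnᴾ-eval : ∀ v → Eval o sgnᴾ (v ∷ []) (sgn v)
  sgnᴾ-eval v = eval-comp₂ (eval-comp₂ ev-proj oneᴾ-eval (monusᴾ-eval v 1)) oneᴾ-eval (monusᴾ-eval _ 1)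

  inner^ᴾ-eval : ∀ t j → Eval o inner^ᴾ (t ∷ j ∷ []) (inner^ t j)
  inner^ᴾ-eval zero    j = ev-prec0 ev-proj
  inner^ᴾ-eval (suc t) j =
    ev-precS (inner^ᴾ-eval t j) (eval-comp₁ (eval-comp₁ ev-proj (unpair₂ᴾ-eval _)) (predᴾ-eval _))

  descentsᴾ-eval : ∀ t j → Eval o descentsᴾ (t ∷ j ∷ []) (descents t j)
  descentsᴾ-eval zero    j = ev-prec0 ev-zer
  descentsᴾ-eval (suc t) j = ev-precS (descentsᴾ-eval t j)
    (eval-comp₂ ev-proj
      (eval-comp₁ (eval-comp₁ (eval-comp₂ ev-proj ev-proj (inner^ᴾ-eval t j)) (unpair₂ᴾ-eval _)) (sgnᴾ-eval _))
      (addᴾ-eval _ _))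

  depthᴾ-eval : ∀ j → Eval o depthᴾ (j ∷ []) (depth j)
  depthᴾ-eval j = eval-comp₂ ev-proj ev-proj (descentsᴾ-eval j j)

  doubleᴾ-eval : ∀ i → Eval o doubleᴾ (i ∷ []) (2 * i)
  doubleᴾ-eval i = eval-cast (eval-comp₂ ev-proj ev-proj (addᴾ-eval i i)) (cong (i +_) (sym (+-identityʳ i)))

  tagEntryᴾ-eval : ∀ v a → Eval o tagEntryᴾ (v ∷ a ∷ []) (relabelEntry ⟨_,_⟩ a v)
  tagEntryᴾ-eval zero    a = ev-prec0 ev-zer
  tagEntryᴾ-eval (suc v) a =
    ev-precS (tagEntryᴾ-eval v a) (eval-comp₁ (eval-comp₂ ev-proj ev-proj (pairᴾ-eval a v)) ev-succ)

  untagEntryᴾ-eval : ∀ v → Eval o untagEntryᴾ (v ∷ []) (relabelEntry (λ _ → unpair₂) 0 v)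
  untagEntryᴾ-eval zero    = ev-prec0 ev-zer
  untagEntryᴾ-eval (suc v) =
    ev-precS (untagEntryᴾ-eval v) (eval-comp₁ (eval-comp₁ ev-proj (unpair₂ᴾ-eval v)) ev-succ)

  parityᴾ-eval : ∀ i → Eval o parityᴾ (i ∷ []) (parity i)
  parityᴾ-eval zero    = ev-prec0 ev-zer
  parityᴾ-eval (suc i) = ev-precS (parityᴾ-eval i) (eval-comp₂ ev-proj oneᴾ-eval (monusᴾ-eval _ _))

  halfᴾ-eval : ∀ i → Eval o halfᴾ (i ∷ []) (half i)
  halfᴾ-eval zero    = ev-prec0 ev-zer
  halfᴾ-eval (suc i) =
    ev-precS (halfᴾ-eval i) (eval-comp₂ ev-proj (eval-comp₁ ev-proj (parityᴾ-eval i)) (addᴾ-eval _ _))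

  ifZeroᴾ-eval : ∀ c a b → Eval o ifZeroᴾ (c ∷ a ∷ b ∷ []) (ifZero c a b)
  ifZeroᴾ-eval zero    a b = ev-prec0 ev-proj
  ifZeroᴾ-eval (suc c) a b = ev-precS (ifZeroᴾ-eval c a b) ev-proj

  searchKeyᴾ-eval : ∀ z n → Eval o searchKeyᴾ (z ∷ n ∷ []) (searchKey o z n)
  searchKeyᴾ-eval z n =
    eval-comp₂ (eval-comp₂ (eval-comp₂ (eval-comp₁ ev-proj (depthᴾ-eval z)) ev-proj (monusᴾ-eval _ _))
                           (eval-comp₂ ev-proj (eval-comp₁ ev-proj (depthᴾ-eval z)) (monusᴾ-eval _ _)) (addᴾ-eval _ _))
               (eval-comp₂ (eval-comp₁ ev-proj ev-orc) oneᴾ-eval (monusᴾ-eval _ _)) (addᴾ-eval _ _)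

  levelValueᴾ-eval : ∀ n → (first : Minimal (NodeAt o n)) →
                     Eval o levelValueᴾ (n ∷ []) (unpair₁ (o (proj₁ first) ∸ 1))
  levelValueᴾ-eval n (y , at , before) =
    eval-comp₁ (eval-comp₁ (eval-comp₁ searched ev-orc) (predᴾ-eval _)) (unpair₁ᴾ-eval _)
    where
    searched : Eval o (mu searchKeyᴾ) (n ∷ []) y
    searched = ev-mu (eval-cast (searchKeyᴾ-eval y n) (NodeAt⇒searchKey≡0 o y n at)) λ z z<y →
      searchKey o z n , (λ key≡0 → before z z<y (searchKey≡0⇒NodeAt o z n key≡0)) , searchKeyᴾ-eval z n

  tagProgram-eval : ∀ i → Eval o tagProgram (i ∷ []) (relabelEntry ⟨_,_⟩ (evens o (depth i)) (odds o i))
  tagProgram-eval i = eval-comp₂ (eval-comp₁ (eval-comp₁ (doubleᴾ-eval i) ev-succ) ev-orc)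
                                 (eval-comp₁ (eval-comp₁ (depthᴾ-eval i) (doubleᴾ-eval _)) ev-orc)
                                 (tagEntryᴾ-eval _ _)

module Reduction (r : Baire) where

  tag untag : ℕ → ℕ → ℕ
  tag d ℓ = ⟨ evens r d , ℓ ⟩
  untag _ ℓ = unpair₂ ℓ

  tagged : Baire
  tagged i = relabelEntry tag (depth i) (odds r i)

  tagged-Relabelled : Relabelled tag 0 (odds r) tagged
  tagged-Relabelled i = refl

  untag-Relabelled : Relabelled untag 0 tagged (odds r)
  untag-Relabelled i = sym (relabelEntry-inverse (λ d → unpair₂-pair (evens r d)) (depth i) (odds r i))

  tagProgram-computes : Computes tagProgram r tagged
  tagProgram-computes i = eval-cast (tagProgram-eval i) (relabelEntry-reindex ⟨_,_⟩ (evens r) (depth i) (odds r i))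

  module Recovery (g : Baire) (out : LinOut tagged g) where

    every-level-occupied : ∀ n → Σ ℕ (NodeAt g n)
    every-level-occupied n =
      let (t , tree , (((b , b∈) , _) , _) , bisim) = proj₁ (proj₂ out)
          (σ , path , len) = Branch-paths bisim (proj₁ tree) b∈ n
      in position σ , subst (λ m → NodeAt g m (position σ)) (cong (_∸ 1) len) (IsPath-NodeAt σ path)

    first : ∀ n → Minimal (NodeAt g n)
    first n = minimal-witness (NodeAt? g n) (proj₂ (every-level-occupied n))

    NodeAt-value : ∀ {n y} → NodeAt g n y → unpair₁ (g y ∸ 1) ≡ evens r n
    NodeAt-value {n} {y} at with NodeAt-IsPath (proj₁ out) at
    ... | σ , path , len≡ , lab with SubtreeAT-path (proj₂ (proj₂ out)) σ path
    ...   | τ , τ-path , len , lab' = begin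
      unpair₁ (g y ∸ 1)                                     ≡⟨ cong unpair₁ (sym lab) ⟩
      unpair₁ (label g σ)                                   ≡⟨ cong unpair₁ lab' ⟩
      unpair₁ (label tagged τ)                              ≡⟨ cong unpair₁ (Relabelled-label τ tagged-Relabelled τ-path₀) ⟩
      unpair₁ ⟨ evens r (length τ ∸ 1) , label (odds r) τ ⟩ ≡⟨ unpair₁-pair _ _ ⟩
      evens r (length τ ∸ 1)                                ≡⟨ cong (λ m → evens r (m ∸ 1)) (sym len) ⟩
      evens r (length σ ∸ 1)                                ≡⟨ cong (evens r) len≡ ⟩
      evens r n                                             ∎
      where
      open ≡-Reasoning
      τ-path₀ = Relabelled-IsPath⁻ τ tagged-Relabelled τ-path

    s : Baire
    s i = ifZero (parity i) (unpair₁ (g (proj₁ (first (half i))) ∸ 1)) (relabelEntry untag 0 (g (half i)))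

    recoverProgram-computes : Computes recoverProgram g s
    recoverProgram-computes i =
      ev-comp (parityᴾ-eval i ∷
               eval-comp₁ (halfᴾ-eval i) (levelValueᴾ-eval (half i) (first (half i))) ∷
               eval-comp₁ (eval-comp₁ (halfᴾ-eval i) ev-orc) (untagEntryᴾ-eval _) ∷ [])
              (ifZeroᴾ-eval _ _ _)

    s-evens : ∀ n → evens s n ≡ evens r n
    s-evens n rewrite proj₁ (parity-half-even n) | proj₂ (parity-half-even n) =
      NodeAt-value (proj₁ (proj₂ (first n)))

    s-odds-Relabelled : Relabelled untag 0 g (odds s)
    s-odds-Relabelled i rewrite proj₁ (parity-half-odd i) | proj₂ (parity-half-odd i) =
      relabelEntry-reindex untag (λ _ → 0) (depth i) (g i)

    s-odds-LinOut : LinOut (odds r) (odds s)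
    s-odds-LinOut = Relabelled-LinOut untag-Relabelled s-odds-Relabelled out

mainTheorem12 : Σ (PR 1) λ h → Σ (PR 1) λ k →
    ∀ (G : Baire → Baire) → RealizesLin G →
    ∀ (r : Baire) → LinDom (odds r) →
    Σ Baire λ q → Computes h r q ×
      Σ Baire λ s → Computes k (G q) s ×
        (∀ n → evens s n ≡ evens r n) × LinOut (odds r) (odds s)
mainTheorem12 = tagProgram , recoverProgram , λ G G⊢Linearize r dom →
  let open Reduction r
      open Recovery (G tagged) (G⊢Linearize tagged (Relabelled-LinDom tagged-Relabelled dom))
  in tagged , tagProgram-computes , s , recoverProgram-computes , s-evens , s-odds-LinOut
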